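{- Let $\Sigma$ be a finite alphabet with $|\Sigma| = s$, let $W$ be any word of length $w$ over $\Sigma$, and let $d$ be an integer with $0 \le d \le w$. Then $$|CN(W,d)| \le \frac{(2s-1)^d\, w^d}{d!}.$$
   Context: For words $U,V$ over $\Sigma$, the Levenshtein distance $d_{lev}(U,V)$ is the minimum number of single-character insertions, deletions and substitutions needed to transform $U$ into $V$. The $d$-neighborhood of $W$ is $N(W,d) = \{U \in \Sigma^* : d_{lev}(U,W) \le d\}$. The condensed $d$-neighborhood is $CN(W,d) = N(W,d) \setminus N(W,d)\Sigma^{+}$, i.e. the set of words of $N(W,d)$ that do not have a proper prefix (a prefix $U$ with the word equal to $UV$ for some nonempty $V$) lying in $N(W,d)$. -}

module Defs where

open import Data.Nat using (ℕ; zero; suc; _≤_)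
open import Data.List using (List; []; _∷_; _++_)
open import Data.Product using (Σ; _×_; ∃; ∃-syntax)
open import Relation.Nullary using (¬_)
open import Relation.Binary.PropositionalEquality using (_≡_)

module _ {A : Set} where

  data EditStep : List A → List A → Set where
    delete     : ∀ x a y → EditStep (x ++ a ∷ y) (x ++ y)
    insert     : ∀ x b y → EditStep (x ++ y) (x ++ b ∷ y)
    substitute : ∀ x a b y → EditStep (x ++ a ∷ y) (x ++ b ∷ y)

  data EditsIn : ℕ → List A → List A → Set where
    done : ∀ {U} → EditsIn zero U U
    step : ∀ {k U V X} → EditStep U V → EditsIn k V X → EditsIn (suc k) U X

  -- d_lev(U , V) ≤ d : the minimal number of edit steps transforming
  -- U into V is at most d, i.e. some transformation uses at most d steps.
  LevDist≤ : ℕ → List A → List A → Set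
  LevDist≤ d U V = ∃[ k ] (k ≤ d × EditsIn k U V)

  InNbhd : List A → ℕ → List A → Set
  InNbhd W d U = LevDist≤ d U W

  -- U ∈ CN(W , d) = N(W,d) \ N(W,d) Σ⁺ :
  -- U ∈ N(W,d) and U has no proper prefix P (U = P ++ V, V nonempty) in N(W,d).
  InCondensedNbhd : List A → ℕ → List A → Set
  InCondensedNbhd W d U =
    InNbhd W d U ×
    ¬ (Σ (List A) λ P → Σ (List A) λ V →
         ¬ (V ≡ []) × U ≡ P ++ V × InNbhd W d P)

{-# OPTIONS --safe #-}
module Submission where

-- Align a word U ∈ CN(W,d) against W = b ∷ W′ and look at the first column: either b is
-- matched, or a letter a ≢ b stands in its place, or b is missing, or U begins with a run of
-- letters ≢ b inserted in front of b.  A run of insertions followed by the loss of b is re-read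
-- as a substitution, so an edit at the head of W is one of t = 2s − 1 kinds.  Once |W| ≤ d the
-- empty word lies in N(W,d) and the condensed condition leaves nothing else.  This gives an
-- explicit list covering CN(W,d) whose length G(w,d) satisfies, for w = |W′| ≥ m + 2,
--   G(w+1, m+2) = G(w, m+2) + t G(w, m+1) + (s−1)² R(w, m),   R(w, m) m! ≤ 2 (wt)^m,
-- where R counts the insertion runs.  As 4(s−1)² ≤ t², the right-hand side is dominated by the
-- first three terms of the binomial expansion of (wt + t)^(m+2) / (m+2)!, and G(w,d) d! ≤ (wt)^d
-- follows by induction on W.

open import Defs
open import Data.Nat using (ℕ; _≤_; _*_; _∸_; _^_; _!)
open import Data.Fin using (Fin)
open import Data.List using (List; length)
open import Data.List.Relation.Unary.All using (All)
open import Data.List.Relation.Unary.Unique.Propositional using (Unique)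

open import Data.Nat using (zero; suc; _+_; z≤n; s≤s; _≤?_)
open import Data.Nat.Properties
open import Data.Nat.Tactic.RingSolver using (solve-∀)
open import Data.Fin using (punchIn; punchOut)
open import Data.Fin.Properties using (punchIn-punchOut) renaming (_≟_ to _≟ᶠ_)
open import Data.List using ([]; _∷_; _++_; [_]; map; allFin; cartesianProductWith)
open import Data.List.Properties using (length-map; length-++; length-tabulate; ++-identityʳ)
open import Data.List.Membership.Propositional using (_∈_)
open import Data.List.Membership.Propositional.Properties
  using (∈-++⁺ˡ; ∈-++⁺ʳ; ∈-++⁻; ∈-map⁺; ∈-∃++; ∈-allFin; ∈-cartesianProductWith⁺)
open import Data.List.Relation.Unary.Any using (here; there)
open import Data.List.Relation.Unary.All using ([]; _∷_)
import Data.List.Relation.Unary.All as All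
open import Data.List.Relation.Unary.AllPairs using ([]; _∷_)
open import Data.Product using (Σ; _×_; _,_)
open import Data.Sum using (_⊎_; inj₁; inj₂)
open import Data.Unit using (⊤; tt)
open import Data.Empty using (⊥-elim)
open import Function using (_∘_; id)
open import Relation.Nullary using (¬_; yes; no)
open import Relation.Binary.Definitions using (DecidableEquality)
open import Relation.Binary.PropositionalEquality
  using (_≡_; _≢_; refl; sym; trans; cong; cong₂; subst; ≢-sym; module ≡-Reasoning)

module _ {B : Set} where

  private
    ∈-delete : ∀ ys {zs} {x y : B} → x ≢ y → y ∈ ys ++ [ x ] ++ zs → y ∈ ys ++ zs
    ∈-delete ys x≢y y∈ with ∈-++⁻ ys y∈
    ... | inj₁ y∈ys          = ∈-++⁺ˡ y∈ys
    ... | inj₂ (here refl)   = ⊥-elim (x≢y refl)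
    ... | inj₂ (there y∈zs)  = ∈-++⁺ʳ ys y∈zs

    length-insert : ∀ (ys zs : List B) x → length (ys ++ [ x ] ++ zs) ≡ suc (length (ys ++ zs))
    length-insert ys zs x = begin
      length (ys ++ x ∷ zs)          ≡⟨ length-++ ys ⟩
      length ys + suc (length zs)    ≡⟨ +-suc (length ys) (length zs) ⟩
      suc (length ys + length zs)    ≡⟨ cong suc (length-++ ys) ⟨
      suc (length (ys ++ zs))        ∎
      where open ≡-Reasoning

  unique⇒length≤ : ∀ {xs ys : List B} → Unique xs → All (_∈ ys) xs → length xs ≤ length ys
  unique⇒length≤ [] [] = z≤n
  unique⇒length≤ (x≢xs ∷ unique) (x∈ys ∷ xs⊆ys) with ys₁ , ys₂ , refl ← ∈-∃++ x∈ys =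
    subst (_ ≤_) (sym (length-insert ys₁ ys₂ _))
      (s≤s (unique⇒length≤ unique (All.zipWith (λ (x≢y , y∈) → ∈-delete ys₁ x≢y y∈) (x≢xs , xs⊆ys))))

module _ {A : Set} where

  private variable
    d e k : ℕ
    a b c : A
    U V W : List A

  data Align : ℕ → List A → List A → Set where
    empty    : Align d [] []
    match    : Align d U W → Align d (a ∷ U) (a ∷ W)
    mismatch : Align d U W → Align (suc d) (a ∷ U) (b ∷ W)
    extra    : Align d U W → Align (suc d) (a ∷ U) W
    missing  : Align d U W → Align (suc d) U (b ∷ W)

  weaken-≤ : d ≤ e → Align d U W → Align e U W
  weaken-≤ d≤e       empty        = empty
  weaken-≤ d≤e       (match α)    = match (weaken-≤ d≤e α)
  weaken-≤ (s≤s d≤e) (mismatch α) = mismatch (weaken-≤ d≤e α)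
  weaken-≤ (s≤s d≤e) (extra α)    = extra (weaken-≤ d≤e α)
  weaken-≤ (s≤s d≤e) (missing α)  = missing (weaken-≤ d≤e α)

  weaken : Align d U W → Align (suc d) U W
  weaken = weaken-≤ (n≤1+n _)

  Align-refl : ∀ U → Align 0 U U
  Align-refl []      = empty
  Align-refl (a ∷ U) = match (Align-refl U)

  []-Align : ∀ W → length W ≤ d → Align d [] W
  []-Align []      _           = empty
  []-Align (b ∷ W) (s≤s |W|≤d) = missing ([]-Align W |W|≤d)

  dropʳ : Align d U (b ∷ W) → Align (suc d) U W
  dropʳ (match α)    = extra α
  dropʳ (mismatch α) = weaken (extra α)
  dropʳ (extra α)    = extra (dropʳ α)
  dropʳ (missing α)  = weaken (weaken α)

  AtMostOneMore : List A → List A → Set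
  AtMostOneMore U V = ∀ {d W} → Align d V W → Align (suc d) U W

  ∷-AtMostOneMore : AtMostOneMore U V → AtMostOneMore (c ∷ U) (c ∷ V)
  ∷-AtMostOneMore f (match α)    = match (f α)
  ∷-AtMostOneMore f (mismatch α) = mismatch (f α)
  ∷-AtMostOneMore f (extra α)    = extra (f α)
  ∷-AtMostOneMore f (missing α)  = missing (∷-AtMostOneMore f α)

  ++-AtMostOneMore : ∀ x → AtMostOneMore U V → AtMostOneMore (x ++ U) (x ++ V)
  ++-AtMostOneMore []      f = f
  ++-AtMostOneMore (c ∷ x) f = ∷-AtMostOneMore (++-AtMostOneMore x f)

  insertion : AtMostOneMore U (b ∷ U)
  insertion (match α)    = missing α
  insertion (mismatch α) = weaken (missing α)
  insertion (extra α)    = weaken (weaken α)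
  insertion (missing α)  = missing (insertion α)

  substitution : AtMostOneMore (a ∷ U) (b ∷ U)
  substitution (match α)    = mismatch α
  substitution (mismatch α) = weaken (mismatch α)
  substitution (extra α)    = weaken (extra α)
  substitution (missing α)  = missing (substitution α)

  EditStep⇒AtMostOneMore : EditStep U V → AtMostOneMore U V
  EditStep⇒AtMostOneMore (delete x a y)       = ++-AtMostOneMore x extra
  EditStep⇒AtMostOneMore (insert x b y)       = ++-AtMostOneMore x insertion
  EditStep⇒AtMostOneMore (substitute x a b y) = ++-AtMostOneMore x substitution

  EditsIn⇒Align : EditsIn k U W → Align k U W
  EditsIn⇒Align done        = Align-refl _
  EditsIn⇒Align (step e es) = EditStep⇒AtMostOneMore e (EditsIn⇒Align es)

  LevDist≤⇒Align : LevDist≤ d U W → Align d U W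
  LevDist≤⇒Align (k , k≤d , es) = weaken-≤ k≤d (EditsIn⇒Align es)

  ∷-EditStep : EditStep U V → EditStep (a ∷ U) (a ∷ V)
  ∷-EditStep {a = a} (delete x b y)       = delete (a ∷ x) b y
  ∷-EditStep {a = a} (insert x b y)       = insert (a ∷ x) b y
  ∷-EditStep {a = a} (substitute x b c y) = substitute (a ∷ x) b c y

  ∷-EditsIn : EditsIn k U V → EditsIn k (a ∷ U) (a ∷ V)
  ∷-EditsIn done        = done
  ∷-EditsIn (step e es) = step (∷-EditStep e) (∷-EditsIn es)

  ∷-LevDist≤ : LevDist≤ d U W → LevDist≤ d (a ∷ U) (a ∷ W)
  ∷-LevDist≤ (k , k≤d , es) = k , k≤d , ∷-EditsIn es

  EditStep-LevDist≤ : EditStep U V → LevDist≤ d V W → LevDist≤ (suc d) U W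
  EditStep-LevDist≤ e (k , k≤d , es) = suc k , s≤s k≤d , step e es

  Align⇒LevDist≤ : Align d U W → LevDist≤ d U W
  Align⇒LevDist≤ empty = 0 , z≤n , done
  Align⇒LevDist≤ (match α) = ∷-LevDist≤ (Align⇒LevDist≤ α)
  Align⇒LevDist≤ (mismatch {U = U} {a = a} {b = b} α) =
    EditStep-LevDist≤ (substitute [] a b U) (∷-LevDist≤ (Align⇒LevDist≤ α))
  Align⇒LevDist≤ (extra {U = U} {a = a} α) =
    EditStep-LevDist≤ (delete [] a U) (Align⇒LevDist≤ α)
  Align⇒LevDist≤ (missing {U = U} {b = b} α) =
    EditStep-LevDist≤ (insert [] b U) (∷-LevDist≤ (Align⇒LevDist≤ α))

  NoProperPrefix : (List A → Set) → List A → Set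
  NoProperPrefix P []      = ⊤
  NoProperPrefix P (a ∷ U) = ¬ P [] × NoProperPrefix (P ∘ (a ∷_)) U

  NoProperPrefix-mono : {P Q : List A → Set} → (∀ {V} → Q V → P V) →
                        NoProperPrefix P U → NoProperPrefix Q U
  NoProperPrefix-mono {U = []}    Q⇒P _              = tt
  NoProperPrefix-mono {U = a ∷ U} Q⇒P (¬P[] , noPre) = ¬P[] ∘ Q⇒P , NoProperPrefix-mono Q⇒P noPre

  NoProperPrefix⇒≡[] : {P : List A → Set} → P [] → NoProperPrefix P U → U ≡ []
  NoProperPrefix⇒≡[] {U = []}    _   _          = refl
  NoProperPrefix⇒≡[] {U = a ∷ U} P[] (¬P[] , _) = ⊥-elim (¬P[] P[])

  ¬ProperPrefix⇒NoProperPrefix :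
    {P : List A → Set} → ∀ U →
    ¬ (Σ (List A) λ U₁ → Σ (List A) λ U₂ → ¬ (U₂ ≡ []) × U ≡ U₁ ++ U₂ × P U₁) →
    NoProperPrefix P U
  ¬ProperPrefix⇒NoProperPrefix []      _       = tt
  ¬ProperPrefix⇒NoProperPrefix (a ∷ U) ¬prefix =
    (λ P[] → ¬prefix ([] , a ∷ U , (λ ()) , refl , P[])) ,
    ¬ProperPrefix⇒NoProperPrefix U
      (λ (U₁ , U₂ , U₂≢[] , U≡ , P[a∷U₁]) → ¬prefix (a ∷ U₁ , U₂ , U₂≢[] , cong (a ∷_) U≡ , P[a∷U₁]))

  Condensed : ℕ → List A → List A → Set
  Condensed d W U = Align d U W × NoProperPrefix (λ P → Align d P W) U

  InCondensedNbhd⇒Condensed : InCondensedNbhd W d U → Condensed d W U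
  InCondensedNbhd⇒Condensed {U = U} (U∈N , ¬prefix) =
    LevDist≤⇒Align U∈N ,
    NoProperPrefix-mono Align⇒LevDist≤ (¬ProperPrefix⇒NoProperPrefix U ¬prefix)

  -- The first column of an alignment against b ∷ W, where a head letter equal to b
  -- is always read as matched.
  data HeadView (b : A) (W : List A) : ℕ → List A → Set where
    head-match    : Align d U W → HeadView b W d (b ∷ U)
    head-mismatch : a ≢ b → Align d U W → HeadView b W (suc d) (a ∷ U)
    head-extra    : a ≢ b → Align d U (b ∷ W) → HeadView b W (suc d) (a ∷ U)
    head-missing  : Align d U W → HeadView b W (suc d) U

  headView : DecidableEquality A → Align d U (b ∷ W) → HeadView b W d U
  headView _≟_ (match α) = head-match α
  headView {b = b} _≟_ (mismatch {a = a} α) with a ≟ b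
  ... | yes refl = head-match (weaken α)
  ... | no a≢b   = head-mismatch a≢b α
  headView {b = b} _≟_ (extra {a = a} α) with a ≟ b
  ... | yes refl = head-match (dropʳ α)
  ... | no a≢b   = head-extra a≢b α
  headView _≟_ (missing α) = head-missing α

m!≤m^m : ∀ m → m ! ≤ m ^ m
m!≤m^m zero    = ≤-refl
m!≤m^m (suc m) = *-monoʳ-≤ (suc m) (≤-trans (m!≤m^m m) (^-monoˡ-≤ m (n≤1+n m)))

^-distribʳ-* : ∀ m n o → (m * n) ^ o ≡ m ^ o * n ^ o
^-distribʳ-* m n zero    = refl
^-distribʳ-* m n (suc o) = begin
  m * n * (m * n) ^ o      ≡⟨ cong (m * n *_) (^-distribʳ-* m n o) ⟩
  m * n * (m ^ o * n ^ o)  ≡⟨ interchange m n (m ^ o) (n ^ o) ⟩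
  m * m ^ o * (n * n ^ o)  ∎
  where
  open ≡-Reasoning
  interchange : ∀ a b c d → a * b * (c * d) ≡ a * c * (b * d)
  interchange = solve-∀

binomial-three-terms : ∀ x y m →
  2 * x ^ (2 + m) + 2 * (2 + m) * y * x ^ (1 + m) + (2 + m) * (1 + m) * (y * y) * x ^ m
    ≤ 2 * (y + x) ^ (2 + m)
binomial-three-terms x y zero = ≤-reflexive (square x y)
  where
  square : ∀ x y → 2 * (x * (x * 1)) + 2 * 2 * y * (x * 1) + 2 * 1 * (y * y) * 1
                   ≡ 2 * ((y + x) * ((y + x) * 1))
  square = solve-∀
binomial-three-terms x y (suc m) = begin
  2 * x ^ (3 + m) + 2 * (3 + m) * y * x ^ (2 + m) + (3 + m) * (2 + m) * (y * y) * x ^ (1 + m)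
    ≤⟨ m≤m+n _ _ ⟩
  2 * x ^ (3 + m) + 2 * (3 + m) * y * x ^ (2 + m) + (3 + m) * (2 + m) * (y * y) * x ^ (1 + m)
    + (2 + m) * (1 + m) * (y * (y * y)) * x ^ m
    ≡⟨ pascal x y m (x ^ m) ⟩
  (y + x) * (2 * x ^ (2 + m) + 2 * (2 + m) * y * x ^ (1 + m) + (2 + m) * (1 + m) * (y * y) * x ^ m)
    ≤⟨ *-monoʳ-≤ (y + x) (binomial-three-terms x y m) ⟩
  (y + x) * (2 * (y + x) ^ (2 + m))
    ≡⟨ left-comm (y + x) 2 ((y + x) ^ (2 + m)) ⟩
  2 * (y + x) ^ (3 + m) ∎
  where
  open ≤-Reasoning
  pascal : ∀ x y m P →
    2 * (x * (x * (x * P))) + 2 * (3 + m) * y * (x * (x * P)) + (3 + m) * (2 + m) * (y * y) * (x * P)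
      + (2 + m) * (1 + m) * (y * (y * y)) * P
    ≡ (y + x) * (2 * (x * (x * P)) + 2 * (2 + m) * y * (x * P) + (2 + m) * (1 + m) * (y * y) * P)
  pascal = solve-∀
  left-comm : ∀ a b c → a * (b * c) ≡ b * (a * c)
  left-comm = solve-∀

length-cartesianProductWith : ∀ {A B C : Set} (f : A → B → C) xs ys →
  length (cartesianProductWith f xs ys) ≡ length xs * length ys
length-cartesianProductWith f []       ys = refl
length-cartesianProductWith f (x ∷ xs) ys = begin
  length (map (f x) ys ++ cartesianProductWith f xs ys)
    ≡⟨ length-++ (map (f x) ys) ⟩
  length (map (f x) ys) + length (cartesianProductWith f xs ys)
    ≡⟨ cong₂ _+_ (length-map (f x) ys) (length-cartesianProductWith f xs ys) ⟩
  length ys + length xs * length ys ∎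
  where open ≡-Reasoning

module CondensedNeighbourhood (n : ℕ) where

  Letter : Set
  Letter = Fin (suc n)

  Word : Set
  Word = List Letter

  private variable
    a b : Letter
    d : ℕ
    U W : Word
    Us : List Word

  others : Letter → Word
  others b = map (punchIn b) (allFin n)

  ∈-others : a ≢ b → a ∈ others b
  ∈-others {a} {b} a≢b =
    subst (_∈ others b) (punchIn-punchOut b≢a) (∈-map⁺ (punchIn b) (∈-allFin (punchOut b≢a)))
    where b≢a = ≢-sym a≢b

  length-others : ∀ b → length (others b) ≡ n
  length-others b = trans (length-map (punchIn b) (allFin n)) (length-tabulate id)

  prependOthers : Letter → List Word → List Word
  prependOthers b = cartesianProductWith _∷_ (others b)

  ∈-prependOthers : a ≢ b → U ∈ Us → a ∷ U ∈ prependOthers b Us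
  ∈-prependOthers a≢b = ∈-cartesianProductWith⁺ _∷_ (∈-others a≢b)

  length-prependOthers : ∀ b Us → length (prependOthers b Us) ≡ n * length Us
  length-prependOthers b Us =
    trans (length-cartesianProductWith _∷_ (others b) Us) (cong (_* length Us) (length-others b))

  mutual
    candidates : Word → ℕ → List Word
    candidates []      d = [ [] ]
    candidates (b ∷ W) d with suc (length W) ≤? d
    ... | yes _ = [ [] ]
    ... | no  _ = candidates-∷ b W d

    candidates-∷ : Letter → Word → ℕ → List Word
    candidates-∷ b W d = insertedThenMatched b W d ++ headReplacedOrDropped b W d

    -- the words a₁ ⋯ aₖ b U with every aᵢ ≢ b and U ∈ candidates W (e ∸ k)
    insertedThenMatched : Letter → Word → ℕ → List Word
    insertedThenMatched b W zero    = map (b ∷_) (candidates W zero)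
    insertedThenMatched b W (suc e) =
      map (b ∷_) (candidates W (suc e)) ++ prependOthers b (insertedThenMatched b W e)

    headReplacedOrDropped : Letter → Word → ℕ → List Word
    headReplacedOrDropped b W zero    = []
    headReplacedOrDropped b W (suc e) = prependOthers b (candidates W e) ++ candidates W e

  ∷-∈-insertedThenMatched : ∀ e → U ∈ candidates W e → b ∷ U ∈ insertedThenMatched b W e
  ∷-∈-insertedThenMatched {b = b} zero    U∈ = ∈-map⁺ (b ∷_) U∈
  ∷-∈-insertedThenMatched {b = b} (suc e) U∈ = ∈-++⁺ˡ (∈-map⁺ (b ∷_) U∈)

  mutual
    candidates-complete : Condensed d W U → U ∈ candidates W d
    candidates-complete {W = []} (α , noPre) = here (NoProperPrefix⇒≡[] empty noPre)
    candidates-complete {d = d} {W = b ∷ W} (α , noPre) with suc (length W) ≤? d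
    ... | yes |bW|≤d = here (NoProperPrefix⇒≡[] ([]-Align (b ∷ W) |bW|≤d) noPre)
    ... | no  _      = candidates-∷-complete (headView _≟ᶠ_ α) noPre

    candidates-∷-complete : HeadView b W d U → NoProperPrefix (λ P → Align d P (b ∷ W)) U →
                            U ∈ candidates-∷ b W d
    candidates-∷-complete {d = d} (head-match α) (_ , noPre) =
      ∈-++⁺ˡ (∷-∈-insertedThenMatched d (candidates-complete (α , NoProperPrefix-mono match noPre)))
    candidates-∷-complete {b = b} {W} (head-mismatch {d = e} a≢b α) (_ , noPre) =
      ∈-++⁺ʳ (insertedThenMatched b W (suc e)) (∈-++⁺ˡ (∈-prependOthers a≢b
        (candidates-complete (α , NoProperPrefix-mono mismatch noPre))))
    candidates-∷-complete {b = b} {W} (head-extra {d = e} a≢b α) (_ , noPre)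
      with insertedThenMatched-complete e (headView _≟ᶠ_ α) (NoProperPrefix-mono extra noPre)
    ... | inj₁ U∈ = ∈-++⁺ˡ (∈-++⁺ʳ (map (b ∷_) (candidates W (suc e))) (∈-prependOthers a≢b U∈))
    ... | inj₂ β  = ∈-++⁺ʳ (insertedThenMatched b W (suc e)) (∈-++⁺ˡ (∈-prependOthers a≢b
                      (candidates-complete (β , NoProperPrefix-mono mismatch noPre))))
    candidates-∷-complete {b = b} {W} (head-missing {d = e} α) noPre =
      ∈-++⁺ʳ (insertedThenMatched b W (suc e)) (∈-++⁺ʳ (prependOthers b (candidates W e))
        (candidates-complete (α , NoProperPrefix-mono missing noPre)))

    insertedThenMatched-complete :
      ∀ e → HeadView b W e U → NoProperPrefix (λ P → Align e P (b ∷ W)) U →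
      U ∈ insertedThenMatched b W e ⊎ Align e U W
    insertedThenMatched-complete e (head-match α) (_ , noPre) =
      inj₁ (∷-∈-insertedThenMatched e (candidates-complete (α , NoProperPrefix-mono match noPre)))
    insertedThenMatched-complete (suc e) (head-mismatch a≢b α) _ = inj₂ (extra α)
    insertedThenMatched-complete {b = b} {W} (suc e) (head-extra a≢b α) (_ , noPre)
      with insertedThenMatched-complete e (headView _≟ᶠ_ α) (NoProperPrefix-mono extra noPre)
    ... | inj₁ U∈ = inj₁ (∈-++⁺ʳ (map (b ∷_) (candidates W (suc e))) (∈-prependOthers a≢b U∈))
    ... | inj₂ β  = inj₂ (extra β)
    insertedThenMatched-complete (suc e) (head-missing α) _ = inj₂ (weaken α)

  -- t = 2s − 1 counts the edits that can replace a letter b at the head of W: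
  -- s − 1 substitutions, s − 1 insertions of a letter ≢ b before b, and the deletion of b.
  t : ℕ
  t = suc (2 * n)

  2nm≤wt : ∀ {m w} → m ≤ w → 2 * n * m ≤ w * t
  2nm≤wt {m} {w} m≤w = begin
    2 * n * m ≤⟨ *-monoʳ-≤ (2 * n) m≤w ⟩
    2 * n * w ≤⟨ *-monoˡ-≤ w (n≤1+n (2 * n)) ⟩
    t * w     ≡⟨ *-comm t w ⟩
    w * t     ∎
    where open ≤-Reasoning

  insertion-run-step : ∀ g r f X → 2 * n * suc f ≤ X →
    g * suc f ! ≤ X ^ suc f → r * f ! ≤ 2 * X ^ f → (g + n * r) * suc f ! ≤ 2 * X ^ suc f
  insertion-run-step g r f X 2n[1+f]≤X g-bound r-bound = begin
    (g + n * r) * suc f !                ≡⟨ expand g r n (suc f) (f !) ⟩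
    g * suc f ! + n * suc f * (r * f !)  ≤⟨ +-mono-≤ g-bound (*-monoʳ-≤ (n * suc f) r-bound) ⟩
    X ^ suc f + n * suc f * (2 * X ^ f)  ≡⟨ cong (X ^ suc f +_) (regroup n (suc f) (X ^ f)) ⟩
    X ^ suc f + 2 * n * suc f * X ^ f    ≤⟨ +-monoʳ-≤ (X ^ suc f) (*-monoˡ-≤ (X ^ f) 2n[1+f]≤X) ⟩
    X ^ suc f + X ^ suc f                ≡⟨ double (X ^ suc f) ⟩
    2 * X ^ suc f                        ∎
    where
    open ≤-Reasoning
    expand : ∀ g r n m F → (g + n * r) * (m * F) ≡ g * (m * F) + n * m * (r * F)
    expand = solve-∀
    regroup : ∀ n m P → n * m * (2 * P) ≡ 2 * n * m * P
    regroup = solve-∀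
    double : ∀ x → x + x ≡ 2 * x
    double = solve-∀

  candidates-step-1 : ∀ g₁ g₀ X → g₁ * 1 ! ≤ X ^ 1 → g₀ * 0 ! ≤ X ^ 0 →
    ((g₁ + n * g₀) + (n * g₀ + g₀)) * 1 ! ≤ (t + X) ^ 1
  candidates-step-1 g₁ g₀ X g₁-bound g₀-bound = begin
    ((g₁ + n * g₀) + (n * g₀ + g₀)) * 1  ≡⟨ expand g₁ g₀ n ⟩
    g₁ * 1 + t * (g₀ * 1)                ≤⟨ +-mono-≤ g₁-bound (*-monoʳ-≤ t g₀-bound) ⟩
    X * 1 + t * 1                        ≡⟨ regroup X t ⟩
    (t + X) * 1                          ∎
    where
    open ≤-Reasoning
    expand : ∀ g₁ g₀ n → ((g₁ + n * g₀) + (n * g₀ + g₀)) * 1 ≡ g₁ * 1 + suc (2 * n) * (g₀ * 1)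
    expand = solve-∀
    regroup : ∀ X t → X * 1 + t * 1 ≡ (t + X) * 1
    regroup = solve-∀

  candidates-step-2+ : ∀ g₂ g₁ r m X →
    g₂ * (2 + m) ! ≤ X ^ (2 + m) → g₁ * (1 + m) ! ≤ X ^ (1 + m) → r * m ! ≤ 2 * X ^ m →
    ((g₂ + n * (g₁ + n * r)) + (n * g₁ + g₁)) * (2 + m) ! ≤ (t + X) ^ (2 + m)
  candidates-step-2+ g₂ g₁ r m X g₂-bound g₁-bound r-bound = *-cancelˡ-≤ 2 (begin
    2 * (((g₂ + n * (g₁ + n * r)) + (n * g₁ + g₁)) * (2 + m) !)
      ≡⟨ expand g₂ g₁ r n m (m !) ⟩
    2 * (g₂ * (2 + m) !) + 2 * (2 + m) * t * (g₁ * (1 + m) !) + c * (2 * n * n) * (r * m !)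
      ≤⟨ +-mono-≤ (+-mono-≤ (*-monoʳ-≤ 2 g₂-bound) (*-monoʳ-≤ (2 * (2 + m) * t) g₁-bound))
                  (*-monoʳ-≤ (c * (2 * n * n)) r-bound) ⟩
    2 * X ^ (2 + m) + 2 * (2 + m) * t * X ^ (1 + m) + c * (2 * n * n) * (2 * X ^ m)
      ≡⟨ cong (2 * X ^ (2 + m) + 2 * (2 + m) * t * X ^ (1 + m) +_) (regroup c n (X ^ m)) ⟩
    2 * X ^ (2 + m) + 2 * (2 + m) * t * X ^ (1 + m) + c * (2 * n * (2 * n)) * X ^ m
      ≤⟨ +-monoʳ-≤ (2 * X ^ (2 + m) + 2 * (2 + m) * t * X ^ (1 + m))
           (*-monoˡ-≤ (X ^ m) (*-monoʳ-≤ c (*-mono-≤ (n≤1+n (2 * n)) (n≤1+n (2 * n))))) ⟩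
    2 * X ^ (2 + m) + 2 * (2 + m) * t * X ^ (1 + m) + c * (t * t) * X ^ m
      ≤⟨ binomial-three-terms X t m ⟩
    2 * (t + X) ^ (2 + m) ∎)
    where
    open ≤-Reasoning
    c = (2 + m) * (1 + m)
    expand : ∀ g₂ g₁ r n m F →
      2 * (((g₂ + n * (g₁ + n * r)) + (n * g₁ + g₁)) * ((2 + m) * ((1 + m) * F)))
      ≡ 2 * (g₂ * ((2 + m) * ((1 + m) * F))) + 2 * (2 + m) * suc (2 * n) * (g₁ * ((1 + m) * F))
        + (2 + m) * (1 + m) * (2 * n * n) * (r * F)
    expand = solve-∀
    regroup : ∀ c n P → c * (2 * n * n) * (2 * P) ≡ c * (2 * n * (2 * n)) * P
    regroup = solve-∀

  full-deletion-bound : ∀ m → 1 * m ! ≤ (m * t) ^ m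
  full-deletion-bound m = begin
    1 * m !     ≡⟨ *-identityˡ (m !) ⟩
    m !         ≤⟨ m!≤m^m m ⟩
    m ^ m       ≤⟨ ^-monoˡ-≤ m (m≤m*n m t) ⟩
    (m * t) ^ m ∎
    where open ≤-Reasoning

  #candidates : Word → ℕ → ℕ
  #candidates W d = length (candidates W d)

  #insertedThenMatched : Letter → Word → ℕ → ℕ
  #insertedThenMatched b W e = length (insertedThenMatched b W e)

  length-insertedThenMatched-zero : ∀ b W → #insertedThenMatched b W zero ≡ #candidates W zero
  length-insertedThenMatched-zero b W = length-map (b ∷_) (candidates W zero)

  length-insertedThenMatched-suc : ∀ b W e →
    #insertedThenMatched b W (suc e) ≡ #candidates W (suc e) + n * #insertedThenMatched b W e
  length-insertedThenMatched-suc b W e =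
    trans (length-++ (map (b ∷_) (candidates W (suc e))))
      (cong₂ _+_ (length-map (b ∷_) (candidates W (suc e)))
                 (length-prependOthers b (insertedThenMatched b W e)))

  length-candidates-∷-suc : ∀ b W e →
    length (candidates-∷ b W (suc e))
      ≡ #insertedThenMatched b W (suc e) + (n * #candidates W e + #candidates W e)
  length-candidates-∷-suc b W e =
    trans (length-++ (insertedThenMatched b W (suc e)))
      (cong (#insertedThenMatched b W (suc e) +_)
        (trans (length-++ (prependOthers b (candidates W e)))
          (cong (_+ #candidates W e) (length-prependOthers b (candidates W e)))))

  length-candidates-∷-0 : ∀ b W → length (candidates-∷ b W 0) ≡ #candidates W 0
  length-candidates-∷-0 b W =
    trans (cong length (++-identityʳ (insertedThenMatched b W 0)))
      (length-insertedThenMatched-zero b W)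

  length-candidates-∷-1 : ∀ b W →
    length (candidates-∷ b W 1)
      ≡ (#candidates W 1 + n * #candidates W 0) + (n * #candidates W 0 + #candidates W 0)
  length-candidates-∷-1 b W = begin
    length (candidates-∷ b W 1)
      ≡⟨ length-candidates-∷-suc b W 0 ⟩
    #insertedThenMatched b W 1 + (n * G₀ + G₀)
      ≡⟨ cong (_+ (n * G₀ + G₀)) (length-insertedThenMatched-suc b W 0) ⟩
    (#candidates W 1 + n * #insertedThenMatched b W 0) + (n * G₀ + G₀)
      ≡⟨ cong (λ r → (#candidates W 1 + n * r) + (n * G₀ + G₀)) (length-insertedThenMatched-zero b W) ⟩
    (#candidates W 1 + n * G₀) + (n * G₀ + G₀) ∎
    where
    open ≡-Reasoning
    G₀ = #candidates W 0

  length-candidates-∷-2+ : ∀ b W m →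
    length (candidates-∷ b W (2 + m))
      ≡ (#candidates W (2 + m) + n * (#candidates W (1 + m) + n * #insertedThenMatched b W m))
        + (n * #candidates W (1 + m) + #candidates W (1 + m))
  length-candidates-∷-2+ b W m = begin
    length (candidates-∷ b W (2 + m))
      ≡⟨ length-candidates-∷-suc b W (1 + m) ⟩
    #insertedThenMatched b W (2 + m) + (n * G₁ + G₁)
      ≡⟨ cong (_+ (n * G₁ + G₁)) (length-insertedThenMatched-suc b W (1 + m)) ⟩
    (#candidates W (2 + m) + n * #insertedThenMatched b W (1 + m)) + (n * G₁ + G₁)
      ≡⟨ cong (λ r → (#candidates W (2 + m) + n * r) + (n * G₁ + G₁)) (length-insertedThenMatched-suc b W m) ⟩
    (#candidates W (2 + m) + n * (G₁ + n * #insertedThenMatched b W m)) + (n * G₁ + G₁) ∎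
    where
    open ≡-Reasoning
    G₁ = #candidates W (1 + m)

  mutual
    candidates-bound : ∀ W d → d ≤ length W → #candidates W d * d ! ≤ (length W * t) ^ d
    candidates-bound []      zero z≤n = ≤-refl
    candidates-bound (b ∷ W) d d≤|bW| with suc (length W) ≤? d
    ... | yes |bW|≤d rewrite ≤-antisym d≤|bW| |bW|≤d = full-deletion-bound (suc (length W))
    ... | no  |bW|≰d = candidates-∷-bound b W d (≤-pred (≰⇒> |bW|≰d))

    candidates-∷-bound : ∀ b W d → d ≤ length W →
      length (candidates-∷ b W d) * d ! ≤ (t + length W * t) ^ d
    candidates-∷-bound b W zero _ =
      ≤-trans (≤-reflexive (cong (_* 1) (length-candidates-∷-0 b W)))
        (candidates-bound W 0 z≤n)
    candidates-∷-bound b W (suc zero) 1≤|W| =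
      ≤-trans (≤-reflexive (cong (_* 1) (length-candidates-∷-1 b W)))
        (candidates-step-1 (#candidates W 1) (#candidates W 0) (length W * t)
          (candidates-bound W 1 1≤|W|) (candidates-bound W 0 z≤n))
    candidates-∷-bound b W (suc (suc m)) 2+m≤|W| =
      ≤-trans (≤-reflexive (cong (_* (2 + m) !) (length-candidates-∷-2+ b W m)))
        (candidates-step-2+ (#candidates W (2 + m)) (#candidates W (1 + m))
          (#insertedThenMatched b W m) m (length W * t)
          (candidates-bound W (2 + m) 2+m≤|W|)
          (candidates-bound W (1 + m) 1+m≤|W|)
          (insertedThenMatched-bound b W m (≤-trans (n≤1+n m) 1+m≤|W|)))
      where 1+m≤|W| = ≤-trans (n≤1+n (suc m)) 2+m≤|W|

    insertedThenMatched-bound : ∀ b W e → e ≤ length W →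
      #insertedThenMatched b W e * e ! ≤ 2 * (length W * t) ^ e
    insertedThenMatched-bound b W zero _ =
      ≤-trans (≤-reflexive (cong (_* 1) (length-insertedThenMatched-zero b W)))
        (≤-trans (candidates-bound W 0 z≤n) (n≤1+n 1))
    insertedThenMatched-bound b W (suc f) 1+f≤|W| =
      ≤-trans (≤-reflexive (cong (_* suc f !) (length-insertedThenMatched-suc b W f)))
        (insertion-run-step (#candidates W (suc f)) (#insertedThenMatched b W f) f (length W * t)
          (2nm≤wt 1+f≤|W|)
          (candidates-bound W (suc f) 1+f≤|W|)
          (insertedThenMatched-bound b W f (≤-trans (n≤1+n f) 1+f≤|W|)))

  condensed-count : ∀ W d → d ≤ length W → {L : List Word} → Unique L →
    All (InCondensedNbhd W d) L → length L * d ! ≤ (length W * t) ^ d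
  condensed-count W d d≤|W| {L} unique L⊆CN = begin
    length L * d !                 ≤⟨ *-monoˡ-≤ (d !) (unique⇒length≤ unique
                                        (All.map (candidates-complete ∘ InCondensedNbhd⇒Condensed) L⊆CN)) ⟩
    length (candidates W d) * d !  ≤⟨ candidates-bound W d d≤|W| ⟩
    (length W * t) ^ d             ∎
    where open ≤-Reasoning

theorem1 : (s : ℕ) (W : List (Fin s)) (d : ℕ) → d ≤ length W →
    (L : List (List (Fin s))) → Unique L → All (InCondensedNbhd W d) L →
    length L * (d !) ≤ ((2 * s) ∸ 1) ^ d * length W ^ d
theorem1 zero    []      zero _ L unique _ =
  *-monoˡ-≤ 1 (unique⇒length≤ unique (All.universal only-[] L))
  where
  only-[] : (U : List (Fin 0)) → U ∈ [ [] ]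
  only-[] [] = here refl
theorem1 zero    (() ∷ _) _ _ _ _ _
theorem1 (suc n) W d d≤|W| L unique L⊆CN = begin
  length L * d !                      ≤⟨ condensed-count W d d≤|W| unique L⊆CN ⟩
  (length W * t) ^ d                  ≡⟨ ^-distribʳ-* (length W) t d ⟩
  length W ^ d * t ^ d                ≡⟨ *-comm (length W ^ d) (t ^ d) ⟩
  t ^ d * length W ^ d                ≡⟨ cong (λ x → x ^ d * length W ^ d) (+-suc n (n + 0)) ⟨
  (2 * suc n ∸ 1) ^ d * length W ^ d  ∎
  where
  open CondensedNeighbourhood n
  open ≤-Reasoning
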